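{- Let $X$ be a weighted sequence of length $n$ over an alphabet $\Sigma$ and let $z>0$. For each position $i$, let $\mathcal{M}_i$ be the unique multiset of strings such that every string $P$ is a prefix of exactly $t_i(P)=\lfloor\mathcal{P}_X(P,i)z\rfloor$ strings in $\mathcal{M}_i$. Then for every $1\le i\le n-1$ there is a one-to-one correspondence from $\mathcal{M}_{i+1}$ onto $\mathcal{M}_i$ (as multisets) such that each $Q\in\mathcal{M}_{i+1}$ is matched with some $P\in\mathcal{M}_i$ compatible with $Q$.
   Context: A weighted sequence $X$ of length $n$ over $\Sigma$ assigns to every position $i$ and letter $c$ a probability $p_i(c)\ge0$ with $\sum_c p_i(c)=1$. For a string $P$ and position $i$, $\mathcal{P}_X(P,i)=\prod_{j=1}^{|P|}p_{i+j-1}(P[j])$ (zero if $P$ extends beyond position $n$; $\mathcal{P}_X(\varepsilon,i)=1$). A string $P\in\mathcal{M}_i$ is compatible with $Q\in\mathcal{M}_{i+1}$ if $P=\varepsilon$ or $P=cQ'$ for some letter $c\in\Sigma$ and some prefix $Q'$ of $Q$.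
   Formalization: The probabilities $p_i(c)$ of the weighted sequence and the parameter $z$ take values in the rationals. -}

module Defs where

open import Data.Nat using (ℕ; zero; suc; _<_; _<?_)
open import Data.Fin using (Fin; fromℕ<; _≟_)
open import Data.List using (List; []; _∷_; length; filter; foldr; map; allFin)
open import Data.Rational using (ℚ; 0ℚ; 1ℚ; _+_; _*_; _≤_)
open import Data.Product using (Σ; ∃; ∃-syntax; _×_; _,_)
open import Data.Sum using (_⊎_)
open import Relation.Nullary using (yes; no)
open import Relation.Binary.PropositionalEquality using (_≡_)
open import Data.List.Relation.Binary.Prefix.Heterogeneous using (Prefix)
open import Data.List.Relation.Binary.Prefix.Heterogeneous.Properties using (prefix?)

String : ℕ → Set
String σ = List (Fin σ)

IsPrefix : ∀ {σ} → String σ → String σ → Set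
IsPrefix = Prefix _≡_

-- Weighted sequence of length n over Fin σ: X i c = p_{i+1}(c) (positions 1..n).
WeightedSeq : ℕ → ℕ → Set
WeightedSeq n σ = Fin n → Fin σ → ℚ

IsWeightedSequence : ∀ {n σ} → WeightedSeq n σ → Set
IsWeightedSequence {n} {σ} X =
  (∀ i c → 0ℚ ≤ X i c) × (∀ i → foldr _+_ 0ℚ (map (X i) (allFin σ)) ≡ 1ℚ)

-- p_j(c) for a 1-based position j; zero outside 1..n.
probAt : ∀ {n σ} → WeightedSeq n σ → ℕ → Fin σ → ℚ
probAt X zero c = 0ℚ
probAt {n} X (suc j) c with j <? n
... | yes j<n = X (fromℕ< j<n) c
... | no _ = 0ℚ

-- 𝒫_X(P, i) = ∏_{j=1}^{|P|} p_{i+j-1}(P[j]), with 1-based i.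
occProb : ∀ {n σ} → WeightedSeq n σ → String σ → ℕ → ℚ
occProb X [] i = 1ℚ
occProb X (c ∷ P) i = probAt X i c * occProb X P (suc i)

prefixCount : ∀ {σ} → String σ → List (String σ) → ℕ
prefixCount P M = length (filter (prefix? _≟_ P) M)

Compatible : ∀ {σ} → String σ → String σ → Set
Compatible {σ} P Q =
  P ≡ [] ⊎ (∃[ c ] ∃[ Q' ] (P ≡ c ∷ Q' × IsPrefix Q' Q))

-- For a string P, the strings of 𝓜ᵢ whose tail begins with P number Σ_c ⌊p_i(c)·𝒫(P,i+1)·z⌋,
-- which by superadditivity of the floor and Σ_c p_i(c) = 1 is at most ⌊𝒫(P,i+1)·z⌋, the
-- number of strings of 𝓜ᵢ₊₁ with prefix P. This Hall-type condition lets a greedy algorithm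
-- build the matching: take a longest nonempty c∷s ∈ 𝓜ᵢ, pair it with some Q ∈ 𝓜ᵢ₊₁ having
-- prefix s, and recurse. The condition survives the removal, since a P that is a prefix of Q
-- but not of s is longer than s, hence than the tail of every remaining string of 𝓜ᵢ. Once
-- only empty strings remain in 𝓜ᵢ, they are compatible with everything.
module Submission where

open import Defs
open import Data.Nat using (ℕ; zero; suc; _+_; _≤_; _<_; _<?_; z≤n; s≤s; s≤s⁻¹)
open import Data.Nat.ListAction using (sum)
import Data.Nat.Properties as ℕ
open import Data.Integer as ℤ using (+_)
import Data.Integer.Properties as ℤ
open import Data.Integer.DivMod using (div-pos-is-/ℕ; [n/d]*d≤n; n<s[n/ℕd]*d)
open import Data.Rational as ℚ using (ℚ; mkℚ; 0ℚ; 1ℚ; _*_; floor; ↧_; toℚᵘ) renaming (_<_ to _<ℚ_)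
import Data.Rational.Properties as ℚ
open import Data.Rational.Unnormalised as ℚᵘ using (*≤*; *≡*)
import Data.Rational.Unnormalised.Properties as ℚᵘ
open import Data.Fin using (Fin; fromℕ<; _≟_) renaming (zero to fzero; suc to fsuc)
open import Data.Fin.Properties using (suc-injective)
open import Data.Fin.Permutation as Perm
  using (Permutation; _⟨$⟩ʳ_; _⟨$⟩ˡ_; lift₀; _∘ₚ_; flip; inverseʳ)
open import Data.List
  using (List; []; _∷_; _++_; length; lookup; filter; foldr; tabulate; map; allFin)
open import Data.List.Properties
  using (filter-accept; filter-reject; filter-none; tabulate-cong; map-tabulate)
open import Data.List.Extrema.Nat using (argmax; argmax-sel; f[xs]≤f[argmax])
open import Data.List.Membership.Propositional using (_∈_)
open import Data.List.Membership.Propositional.Properties using (∈-∃++; ∈-filter⁻)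
open import Data.List.Relation.Unary.Any using (here)
open import Data.List.Relation.Unary.All as All using (All; []; _∷_)
open import Data.List.Relation.Binary.Permutation.Propositional
  using (_↭_; prep; swap; ↭-sym) renaming (refl to ↭-refl; trans to ↭-trans)
open import Data.List.Relation.Binary.Permutation.Propositional.Properties
  using (↭-length; filter-↭; All-resp-↭; shift)
open import Data.List.Relation.Binary.Prefix.Heterogeneous using ([]; _∷_; head; tail)
open import Data.List.Relation.Binary.Prefix.Heterogeneous.Properties
  using (prefix?; length-mono; fromPointwise) renaming (trans to prefix-trans)
import Data.List.Relation.Binary.Pointwise as Pointwise
open import Data.Empty using (⊥; ⊥-elim)
open import Data.Product using (Σ; ∃-syntax; _×_; _,_)
open import Data.Sum using (inj₁; inj₂)
open import Function using (_∘_)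
open import Function.Bundles using (_⤖_; Bijection)
open import Function.Properties.Inverse using (↔⇒⤖)
open import Relation.Nullary using (Dec; yes; no; ¬_)
open import Relation.Unary using (Decidable)
open import Relation.Binary.PropositionalEquality
  using (_≡_; _≢_; refl; sym; trans; cong; cong₂; subst; subst₂; _≗_; module ≡-Reasoning)

floor-≤ : ∀ p → floor p ℚᵘ./ 1 ℚᵘ.≤ toℚᵘ p
floor-≤ p@(mkℚ n _ _) = *≤* (begin
  floor p ℤ.* ↧ p  ≤⟨ [n/d]*d≤n n (↧ p) ⟩
  n                ≡⟨ ℤ.*-identityʳ n ⟨
  n ℤ.* + 1        ∎)
  where open ℤ.≤-Reasoning

floor-greatest : ∀ p {k} → k ℚᵘ./ 1 ℚᵘ.≤ toℚᵘ p → k ℤ.≤ floor p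
floor-greatest p@(mkℚ n d _) {k} (*≤* k↧≤n) = ℤ.≮⇒≥ λ floor<k → ℤ.<-irrefl refl (begin-strict
  n                               <⟨ n<s[n/ℕd]*d n (suc d) ⟩
  ℤ.suc (n ℤ./ℕ suc d) ℤ.* ↧ p    ≡⟨ cong (λ f → ℤ.suc f ℤ.* ↧ p) (div-pos-is-/ℕ n (suc d)) ⟨
  ℤ.suc (floor p) ℤ.* ↧ p         ≤⟨ ℤ.*-monoʳ-≤-nonNeg (↧ p) (ℤ.i<j⇒suc[i]≤j floor<k) ⟩
  k ℤ.* ↧ p                       ≤⟨ k↧≤n ⟩
  n ℤ.* + 1                       ≡⟨ ℤ.*-identityʳ n ⟩
  n                               ∎)
  where open ℤ.≤-Reasoning

/1-homo-+ : ∀ i j → (i ℤ.+ j) ℚᵘ./ 1 ℚᵘ.≃ i ℚᵘ./ 1 ℚᵘ.+ j ℚᵘ./ 1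
/1-homo-+ i j = *≡* (cong (ℤ._* + 1) (sym (cong₂ ℤ._+_ (ℤ.*-identityʳ i) (ℤ.*-identityʳ j))))

floor-superadditive : ∀ p q → floor p ℤ.+ floor q ℤ.≤ floor (p ℚ.+ q)
floor-superadditive p q = floor-greatest (p ℚ.+ q) (begin
  (floor p ℤ.+ floor q) ℚᵘ./ 1        ≃⟨ /1-homo-+ (floor p) (floor q) ⟩
  floor p ℚᵘ./ 1 ℚᵘ.+ floor q ℚᵘ./ 1  ≤⟨ ℚᵘ.+-mono-≤ (floor-≤ p) (floor-≤ q) ⟩
  toℚᵘ p ℚᵘ.+ toℚᵘ q                  ≃⟨ ℚ.toℚᵘ-homo-+ p q ⟨
  toℚᵘ (p ℚ.+ q)                      ∎)
  where open ℚᵘ.≤-Reasoning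

∑ : ∀ {k} → (Fin k → ℕ) → ℕ
∑ f = sum (tabulate f)

∑ℚ : ∀ {k} → (Fin k → ℚ) → ℚ
∑ℚ f = foldr ℚ._+_ 0ℚ (tabulate f)

∑-cong : ∀ {k} {f g : Fin k → ℕ} → f ≗ g → ∑ f ≡ ∑ g
∑-cong f≗g = cong sum (tabulate-cong f≗g)

∑-zero : ∀ k → ∑ {k} (λ _ → 0) ≡ 0
∑-zero zero    = refl
∑-zero (suc k) = ∑-zero k

∑-suc-at : ∀ {k} (f g : Fin k → ℕ) d → f d ≡ suc (g d) → (∀ c → c ≢ d → f c ≡ g c) →
           ∑ f ≡ suc (∑ g)
∑-suc-at f g fzero    at off = cong₂ _+_ at (∑-cong λ c → off (fsuc c) λ ())
∑-suc-at f g (fsuc d) at off = trans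
  (cong₂ _+_ (off fzero λ ())
              (∑-suc-at (f ∘ fsuc) (g ∘ fsuc) d at λ c c≢d → off (fsuc c) (c≢d ∘ suc-injective)))
  (ℕ.+-suc (g fzero) _)

∑-≤-floor-∑ℚ : ∀ {k} (m : Fin k → ℕ) (f : Fin k → ℚ) r →
               (∀ c → + m c ℤ.≤ floor (f c * r)) → + ∑ m ℤ.≤ floor (∑ℚ f * r)
∑-≤-floor-∑ℚ {zero}  m f r _  = ℤ.≤-reflexive (cong floor (sym (ℚ.*-zeroˡ r)))
∑-≤-floor-∑ℚ {suc k} m f r le = begin
  + (m fzero + ∑ (m ∘ fsuc))                    ≡⟨ ℤ.pos-+ (m fzero) _ ⟩
  + m fzero ℤ.+ + ∑ (m ∘ fsuc)                    ≤⟨ ℤ.+-mono-≤ (le fzero) (∑-≤-floor-∑ℚ _ _ r (le ∘ fsuc)) ⟩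
  floor (f fzero * r) ℤ.+ floor (∑ℚ (f ∘ fsuc) * r) ≤⟨ floor-superadditive (f fzero * r) _ ⟩
  floor (f fzero * r ℚ.+ ∑ℚ (f ∘ fsuc) * r)        ≡⟨ cong floor (ℚ.*-distribʳ-+ r (f fzero) _) ⟨
  floor (∑ℚ f * r)                                ∎
  where open ℤ.≤-Reasoning

module _ {σ : ℕ} where

  TailPrefix : String σ → String σ → Set
  TailPrefix P []      = ⊥
  TailPrefix P (_ ∷ a) = IsPrefix P a

  tailPrefix? : ∀ P → Decidable (TailPrefix P)
  tailPrefix? P []      = no λ ()
  tailPrefix? P (_ ∷ a) = prefix? _≟_ P a

  tailPrefixCount : String σ → List (String σ) → ℕ
  tailPrefixCount P A = length (filter (tailPrefix? P) A)

  TailsDominated : List (String σ) → List (String σ) → Set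
  TailsDominated A B = ∀ P → tailPrefixCount P A ≤ prefixCount P B

  ∑-prefixCount≡tailPrefixCount : ∀ P A → ∑ (λ c → prefixCount (c ∷ P) A) ≡ tailPrefixCount P A
  ∑-prefixCount≡tailPrefixCount P []            = ∑-zero σ
  ∑-prefixCount≡tailPrefixCount P ([] ∷ A)      = ∑-prefixCount≡tailPrefixCount P A
  ∑-prefixCount≡tailPrefixCount P ((d ∷ a) ∷ A) = split (prefix? _≟_ P a)
    where
    open ≡-Reasoning
    split : Dec (IsPrefix P a) →
            ∑ (λ c → prefixCount (c ∷ P) ((d ∷ a) ∷ A)) ≡ tailPrefixCount P ((d ∷ a) ∷ A)
    split (yes P⊑a) = begin
      ∑ (λ c → prefixCount (c ∷ P) ((d ∷ a) ∷ A))  ≡⟨ ∑-suc-at _ _ d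
          (cong length (filter-accept (prefix? _≟_ (d ∷ P)) (refl ∷ P⊑a)))
          (λ c c≢d → cong length (filter-reject (prefix? _≟_ (c ∷ P)) (c≢d ∘ head))) ⟩
      suc (∑ (λ c → prefixCount (c ∷ P) A))       ≡⟨ cong suc (∑-prefixCount≡tailPrefixCount P A) ⟩
      suc (tailPrefixCount P A)                   ≡⟨ cong length (filter-accept (tailPrefix? P) P⊑a) ⟨
      tailPrefixCount P ((d ∷ a) ∷ A)             ∎
    split (no P⋢a) = begin
      ∑ (λ c → prefixCount (c ∷ P) ((d ∷ a) ∷ A))  ≡⟨ ∑-cong (λ c →
          cong length (filter-reject (prefix? _≟_ (c ∷ P)) (P⋢a ∘ tail))) ⟩
      ∑ (λ c → prefixCount (c ∷ P) A)             ≡⟨ ∑-prefixCount≡tailPrefixCount P A ⟩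
      tailPrefixCount P A                         ≡⟨ cong length (filter-reject (tailPrefix? P) P⋢a) ⟨
      tailPrefixCount P ((d ∷ a) ∷ A)             ∎

  prefixCount-[] : ∀ A → prefixCount {σ} [] A ≡ length A
  prefixCount-[] []      = refl
  prefixCount-[] (_ ∷ A) = cong suc (prefixCount-[] A)

∑ℚ-probAt≡1 : ∀ {n σ} (X : WeightedSeq n σ) → IsWeightedSequence X → ∀ {i} → i < n →
              ∑ℚ (probAt X (suc i)) ≡ 1ℚ
∑ℚ-probAt≡1 {n} {σ} X (_ , sums-to-1) {i} i<n = begin
  ∑ℚ (probAt X (suc i))                             ≡⟨ cong (foldr ℚ._+_ 0ℚ) (tabulate-cong probAt-suc) ⟩
  ∑ℚ (X j)                                          ≡⟨ cong (foldr ℚ._+_ 0ℚ) (map-tabulate (λ c → c) (X j)) ⟨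
  foldr ℚ._+_ 0ℚ (map (X j) (allFin σ))             ≡⟨ sums-to-1 j ⟩
  1ℚ                                                ∎
  where
  open ≡-Reasoning
  j = fromℕ< i<n
  probAt-suc : ∀ c → probAt X (suc i) c ≡ X j c
  probAt-suc c with i <? n
  ... | yes i<n′ = cong (λ i<n → X (fromℕ< i<n) c) (ℕ.<-irrelevant i<n′ i<n)
  ... | no i≮n   = ⊥-elim (i≮n i<n)

floorCounts⇒tailsDominated :
  ∀ {n σ} (X : WeightedSeq n σ) (z : ℚ) {i} (A B : List (String σ)) → ∑ℚ (probAt X i) ≡ 1ℚ →
  (∀ P → + prefixCount P A ≡ floor (occProb X P i * z)) →
  (∀ P → + prefixCount P B ≡ floor (occProb X P (suc i) * z)) →
  TailsDominated A B
floorCounts⇒tailsDominated X z {i} A B ∑p≡1 countA countB P = ℤ.drop‿+≤+ (begin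
  + tailPrefixCount P A                    ≡⟨ cong +_ (∑-prefixCount≡tailPrefixCount P A) ⟨
  + ∑ (λ c → prefixCount (c ∷ P) A)        ≤⟨ ∑-≤-floor-∑ℚ _ (probAt X i) r (λ c → ℤ.≤-reflexive
      (trans (countA (c ∷ P)) (cong floor (ℚ.*-assoc (probAt X i c) _ z)))) ⟩
  floor (∑ℚ (probAt X i) * r)              ≡⟨ cong (λ t → floor (t * r)) ∑p≡1 ⟩
  floor (1ℚ * r)                           ≡⟨ cong floor (ℚ.*-identityˡ r) ⟩
  floor r                                  ≡⟨ countB P ⟨
  + prefixCount P B                        ∎)
  where
  open ℤ.≤-Reasoning
  r = occProb X P (suc i) * z

record Matching {A B : Set} (R : A → B → Set) (xs : List A) (ys : List B) : Set where
  constructor _,_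
  field
    permutation : Permutation (length ys) (length xs)
    related     : ∀ k → R (lookup xs (permutation ⟨$⟩ʳ k)) (lookup ys k)

↭⇒permutation : ∀ {A : Set} {xs ys : List A} → xs ↭ ys →
                Σ (Permutation (length xs) (length ys)) λ π →
                  ∀ k → lookup ys (π ⟨$⟩ʳ k) ≡ lookup xs k
↭⇒permutation ↭-refl = Perm.id , λ _ → refl
↭⇒permutation (prep x p) with π , lookup-π ← ↭⇒permutation p =
  lift₀ π , λ { fzero → refl ; (fsuc k) → lookup-π k }
↭⇒permutation (swap x y p) with π , lookup-π ← ↭⇒permutation p =
  Perm.swap π , λ { fzero → refl ; (fsuc fzero) → refl ; (fsuc (fsuc k)) → lookup-π k }
↭⇒permutation (↭-trans p q) with π , lookup-π ← ↭⇒permutation p | ρ , lookup-ρ ← ↭⇒permutation q =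
  π ∘ₚ ρ , λ k → trans (lookup-ρ (π ⟨$⟩ʳ k)) (lookup-π k)

module _ {A B : Set} {R : A → B → Set} where

  matching-[] : Matching R [] []
  matching-[] = Perm.id , λ ()

  matching-∷ : ∀ {x y xs ys} → R x y → Matching R xs ys → Matching R (x ∷ xs) (y ∷ ys)
  matching-∷ Rxy (π , R-π) = lift₀ π , λ { fzero → Rxy ; (fsuc k) → R-π k }

  matching-respˡ-↭ : ∀ {xs xs′ ys} → xs ↭ xs′ → Matching R xs ys → Matching R xs′ ys
  matching-respˡ-↭ p (π , R-π) with ρ , lookup-ρ ← ↭⇒permutation p =
    π ∘ₚ ρ , λ k → subst (λ x → R x _) (sym (lookup-ρ (π ⟨$⟩ʳ k))) (R-π k)

  matching-respʳ-↭ : ∀ {xs ys ys′} → ys ↭ ys′ → Matching R xs ys → Matching R xs ys′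
  matching-respʳ-↭ {xs} {ys} {ys′} p (π , R-π) with ρ , lookup-ρ ← ↭⇒permutation p =
    flip ρ ∘ₚ π , λ k → subst (R _) (lookup-flip k) (R-π (ρ ⟨$⟩ˡ k))
    where
    lookup-flip : ∀ k → lookup ys (ρ ⟨$⟩ˡ k) ≡ lookup ys′ k
    lookup-flip k = trans (sym (lookup-ρ (ρ ⟨$⟩ˡ k))) (cong (lookup ys′) (inverseʳ ρ))

∈⇒↭∷ : ∀ {A : Set} {x : A} {xs} → x ∈ xs → ∃[ ys ] xs ↭ x ∷ ys
∈⇒↭∷ x∈xs with ys , zs , refl ← ∈-∃++ x∈xs = ys ++ zs , shift _ ys zs

filter-nonempty⇒∃ : ∀ {A : Set} {P : A → Set} (P? : Decidable P) xs →
                    0 < length (filter P? xs) → ∃[ x ] x ∈ xs × P x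
filter-nonempty⇒∃ P? xs nonempty with filter P? xs in eq
... | x ∷ _ = x , ∈-filter⁻ P? (subst (x ∈_) (sym eq) (here refl))

module _ {σ : ℕ} where

  prefix-≤-length : ∀ {P s b : String σ} → IsPrefix P b → IsPrefix s b →
                    length P ≤ length s → IsPrefix P s
  prefix-≤-length []          _           _          = []
  prefix-≤-length (refl ∷ P⊑b) (refl ∷ s⊑b) (s≤s |P|≤|s|) = refl ∷ prefix-≤-length P⊑b s⊑b |P|≤|s|

  tailPrefixCount-short : ∀ {m P} {A : List (String σ)} → m < length P →
                          All (λ a → length a ≤ suc m) A → tailPrefixCount P A ≡ 0
  tailPrefixCount-short {m} {P} m<|P| short =
    cong length (filter-none (tailPrefix? P) (All.map no-tail-prefix short))
    where
    no-tail-prefix : ∀ {a} → length a ≤ suc m → ¬ TailPrefix P a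
    no-tail-prefix {_ ∷ _} (s≤s |a|≤m) P⊑a =
      ℕ.<-irrefl refl (ℕ.<-≤-trans m<|P| (ℕ.≤-trans (length-mono P⊑a) |a|≤m))

  tailsDominated-resp-↭ : ∀ {A A′ B B′ : List (String σ)} → A ↭ A′ → B ↭ B′ →
                          TailsDominated A B → TailsDominated A′ B′
  tailsDominated-resp-↭ A↭ B↭ dom P =
    subst₂ _≤_ (↭-length (filter-↭ (tailPrefix? P) A↭))
               (↭-length (filter-↭ (prefix? _≟_ P) B↭))
               (dom P)

  tailsDominated-remove : ∀ {c s b} {A B : List (String σ)} → IsPrefix s b →
                          All (λ a → length a ≤ suc (length s)) A →
                          TailsDominated ((c ∷ s) ∷ A) (b ∷ B) → TailsDominated A B
  tailsDominated-remove {s = s} {b} {A} {B} s⊑b short dom P with prefix? _≟_ P s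
  ... | yes P⊑s = s≤s⁻¹ (subst₂ _≤_
    (cong length (filter-accept (tailPrefix? P) P⊑s))
    (cong length (filter-accept (prefix? _≟_ P) (prefix-trans trans P⊑s s⊑b)))
    (dom P))
  ... | no P⋢s with prefix? _≟_ P b
  ...   | yes P⊑b = subst (_≤ prefixCount P B) (sym (tailPrefixCount-short |s|<|P| short)) z≤n
    where
    |s|<|P| : length s < length P
    |s|<|P| = ℕ.≰⇒> (P⋢s ∘ prefix-≤-length P⊑b s⊑b)
  ...   | no P⋢b = subst₂ _≤_
    (cong length (filter-reject (tailPrefix? P) P⋢s))
    (cong length (filter-reject (prefix? _≟_ P) P⋢b))
    (dom P)

  matching-empty : ∀ {A B : List (String σ)} → All (λ a → length a ≤ 0) A → length A ≡ length B →
                   Matching Compatible A B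
  matching-empty {[]}     {[]}    []            _       = matching-[]
  matching-empty {[] ∷ A} {_ ∷ B} (z≤n ∷ empty) |A|≡|B| =
    matching-∷ (inj₁ refl) (matching-empty empty (ℕ.suc-injective |A|≡|B|))

  compatibleMatching : ∀ k (A B : List (String σ)) → length A ≡ k → length A ≡ length B →
                       TailsDominated A B → Matching Compatible A B
  compatibleMatching k A B |A|≡k |A|≡|B| dom
    with argmax length [] A | f[xs]≤f[argmax] {f = length} [] A | argmax-sel length [] A
  ... | []    | empty | _ = matching-empty empty |A|≡|B|
  ... | c ∷ s | _       | inj₁ ()
  compatibleMatching zero    []      B _  _ _ | c ∷ s | _ | inj₂ ()
  compatibleMatching zero    (_ ∷ _) B () _ _ | c ∷ s | _ | inj₂ _
  compatibleMatching (suc k) A       B |A|≡1+k |A|≡|B| dom | c ∷ s | bounded | inj₂ cs∈A =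
    let A₀ , A↭ = ∈⇒↭∷ cs∈A
        domA = tailsDominated-resp-↭ A↭ (↭-refl {xs = B}) dom
        b , b∈B , s⊑b = filter-nonempty⇒∃ (prefix? _≟_ s) B
                          (ℕ.<-≤-trans (tail-s-counted A₀) (domA s))
        B₀ , B↭ = ∈⇒↭∷ b∈B
        dom₀ = tailsDominated-remove s⊑b (All.tail (All-resp-↭ A↭ bounded))
                 (tailsDominated-resp-↭ (↭-refl {xs = (c ∷ s) ∷ A₀}) B↭ domA)
        |A|≡1+|A₀| = ↭-length A↭
        matching₀ = compatibleMatching k A₀ B₀
          (ℕ.suc-injective (trans (sym |A|≡1+|A₀|) |A|≡1+k))
          (ℕ.suc-injective (trans (sym |A|≡1+|A₀|) (trans |A|≡|B| (↭-length B↭))))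
          dom₀
    in matching-respˡ-↭ (↭-sym A↭) (matching-respʳ-↭ (↭-sym B↭)
         (matching-∷ (inj₂ (c , s , refl , s⊑b)) matching₀))
    where
    tail-s-counted : ∀ A₀ → 0 < tailPrefixCount s ((c ∷ s) ∷ A₀)
    tail-s-counted A₀ = subst (0 <_)
      (sym (cong length (filter-accept (tailPrefix? s) (fromPointwise (Pointwise.refl refl)))))
      (s≤s z≤n)

lemma2 : ∀ {n σ : ℕ} (X : WeightedSeq n σ) → IsWeightedSequence X →
         (z : ℚ) → 0ℚ <ℚ z →
         (M : ℕ → List (String σ)) →
         (∀ i → 1 ≤ i → i ≤ n → ∀ (P : String σ) →
            + prefixCount P (M i) ≡ floor (occProb X P i * z)) →
         ∀ i → 1 ≤ i → i < n →
         Σ (Fin (length (M (suc i))) ⤖ Fin (length (M i))) λ f →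
           ∀ k → Compatible (lookup (M i) (Bijection.to f k)) (lookup (M (suc i)) k)
lemma2 X weighted z _ M counts (suc i) _ 2+i≤n = ↔⇒⤖ π , related
  where
  countsᵢ   = counts (suc i) (s≤s z≤n) (ℕ.<⇒≤ 2+i≤n)
  countsᵢ₊₁ = counts (suc (suc i)) (s≤s z≤n) 2+i≤n

  equal-sizes : length (M (suc i)) ≡ length (M (suc (suc i)))
  equal-sizes = ℤ.+-injective (begin
    + length (M (suc i))              ≡⟨ cong +_ (prefixCount-[] (M (suc i))) ⟨
    + prefixCount [] (M (suc i))       ≡⟨ trans (countsᵢ []) (sym (countsᵢ₊₁ [])) ⟩
    + prefixCount [] (M (suc (suc i))) ≡⟨ cong +_ (prefixCount-[] (M (suc (suc i)))) ⟩
    + length (M (suc (suc i)))        ∎)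
    where open ≡-Reasoning

  dominated : TailsDominated (M (suc i)) (M (suc (suc i)))
  dominated = floorCounts⇒tailsDominated X z (M (suc i)) (M (suc (suc i)))
    (∑ℚ-probAt≡1 X weighted (ℕ.<-trans (ℕ.n<1+n i) 2+i≤n)) countsᵢ countsᵢ₊₁

  open Matching (compatibleMatching _ (M (suc i)) (M (suc (suc i))) refl equal-sizes dominated)
    renaming (permutation to π)
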